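{- Let $G_\infty$ be the infinite hexagonal grid and $W\subset V(G_\infty)$ a finite set having no bad row in any of the three directions. Then every vertex of $G_\infty$ is an outermost neighbor of $W$ for at most two of the three directions.
   Context: The infinite hexagonal grid $G_\infty$ is the graph formed by the vertices and edges of the tiling of the plane by regular hexagons. Every edge of $G_\infty$ is parallel to exactly one of three directions $1,2,3$. For $i\in\{1,2,3\}$, deleting all edges parallel to direction $i$ leaves a graph whose connected components (bi-infinite paths) are the rows of direction $i$. A row is gray (w.r.t. $W$) if it contains a vertex of $W$ and white otherwise; a row of direction $i$ is bad if it is white and lies strictly between two gray rows of direction $i$. For a gray row $R$ of direction $i$, the two outermost neighbors of $W$ in $R$ are the two vertices of $R$ not in $W$ that are adjacent (along the path $R$) to the first, respectively last, vertex of $W\cap R$ along $R$; i.e. they are the vertices $v\in R\setminus W$ adjacent in $R$ to a vertex of $W\cap R$ such that all of $W\cap R$ lies on one side of $v$ in $R$. A vertex is an outermost neighbor of $W$ for direction $i$ if it is an outermost neighbor of $W$ in some gray row of direction $i$. -}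

module Defs where

open import Data.Integer using (ℤ; _+_; _-_; _<_; 0ℤ; 1ℤ)
open import Data.Product using (_×_; _,_; ∃; ∃-syntax)
open import Data.Sum using (_⊎_)
open import Data.List using (List)
open import Data.List.Membership.Propositional using (_∈_; _∉_)
open import Relation.Binary.PropositionalEquality using (_≡_; _≢_)
open import Relation.Nullary using (¬_)

-- Model of the infinite hexagonal grid G∞ (honeycomb):
-- vertices are integer triples (x , y , z) with x + y + z ∈ {0, 1}.
-- A vertex with sum 0 ("black") u is joined to the three vertices u + eᵢ
-- (sum 1, "white"); the edge {u , u + eᵢ} is parallel to direction i.
Pt : Set
Pt = ℤ × ℤ × ℤ

data Dir : Set where
  d1 d2 d3 : Dir

csum : Pt → ℤ
csum (x , y , z) = x + y + z

IsVertex : Pt → Set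
IsVertex p = (csum p ≡ 0ℤ) ⊎ (csum p ≡ 1ℤ)

shift : Dir → Pt → Pt
shift d1 (x , y , z) = (x + 1ℤ , y , z)
shift d2 (x , y , z) = (x , y + 1ℤ , z)
shift d3 (x , y , z) = (x , y , z + 1ℤ)

Edge : Dir → Pt → Pt → Set
Edge j u v = (csum u ≡ 0ℤ × v ≡ shift j u) ⊎ (csum v ≡ 0ℤ × u ≡ shift j v)

-- Edges not parallel to i preserve coordinate i, so the rows of direction i
-- (components after deleting the edges parallel to i) are exactly the sets
-- { v : coord i v ≡ c }, c ∈ ℤ; they are parallel and ordered by c.
coord : Dir → Pt → ℤ
coord d1 (x , y , z) = x
coord d2 (x , y , z) = y
coord d3 (x , y , z) = z

-- Position along a row of direction i: consecutive vertices of the row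
-- (bi-infinite path) have positions differing by exactly 1.
pos : Dir → Pt → ℤ
pos d1 (x , y , z) = y - z
pos d2 (x , y , z) = z - x
pos d3 (x , y , z) = x - y

RowAdj : Dir → Pt → Pt → Set
RowAdj i u v = ∃[ j ] (j ≢ i × Edge j u v)

Gray : List Pt → Dir → ℤ → Set
Gray W i c = ∃[ w ] (w ∈ W × coord i w ≡ c)

White : List Pt → Dir → ℤ → Set
White W i c = ¬ Gray W i c

Bad : List Pt → Dir → ℤ → Set
Bad W i c = White W i c
          × (∃[ c₁ ] (c₁ < c × Gray W i c₁))
          × (∃[ c₂ ] (c < c₂ × Gray W i c₂))

NoBadRow : List Pt → Set
NoBadRow W = ∀ i c → ¬ Bad W i c

OutermostNeighbor : List Pt → Dir → Pt → Set
OutermostNeighbor W i v =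
    IsVertex v
  × v ∉ W
  × (∃[ w ] (w ∈ W × coord i w ≡ coord i v × RowAdj i v w))
  × ( (∀ u → u ∈ W → coord i u ≡ coord i v → pos i u < pos i v)
    ⊎ (∀ u → u ∈ W → coord i u ≡ coord i v → pos i v < pos i u))

module Submission where

open import Defs
open import Data.Product using (_×_; _,_; ∃-syntax)
open import Data.Sum using (_⊎_; inj₁; inj₂)
open import Data.List using (List)
open import Data.List.Relation.Unary.All using (All)
open import Data.List.Membership.Propositional using (_∈_)
open import Data.Integer using (_+_; _-_; _<_; 0ℤ; 1ℤ; suc)
open import Data.Integer.Properties using (suc[i]≤j⇒i<j; ≤-refl; <-asym)
open import Data.Integer.Tactic.RingSolver using (solve-∀)
open import Relation.Nullary using (¬_)
open import Relation.Binary.PropositionalEquality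

-- The witnesses in W for the three directions are reached from v along edges of
-- at least two distinct directions j ≠ k, since the witness for direction i is
-- reached along an edge not parallel to i.
-- For the third direction l, the edges of directions j and k are exactly the two
-- edges of the row of direction l through v, and they leave v on opposite sides
-- of it; so W meets that row on both sides of v, and v is not outermost there.

next prev : Dir → Dir
next d1 = d2
next d2 = d3
next d3 = d1
prev d1 = d3
prev d2 = d1
prev d3 = d2

fixpointFree⇒hits-next-and-prev : (f : Dir → Dir) → (∀ i → f i ≢ i) →
                                  ∃[ l ] ∃[ i ] ∃[ i′ ] (f i ≡ next l × f i′ ≡ prev l)
fixpointFree⇒hits-next-and-prev f f≢ with f d1 in e₁ | f d2 in e₂ | f d3 in e₃
... | d1 | _  | _  with () ← f≢ d1 e₁
... | _  | d2 | _  with () ← f≢ d2 e₂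
... | _  | _  | d3 with () ← f≢ d3 e₃
... | d2 | d1 | _  = d3 , d2 , d1 , e₂ , e₁
... | d2 | d3 | _  = d1 , d1 , d2 , e₁ , e₂
... | d3 | d1 | _  = d2 , d1 , d2 , e₁ , e₂
... | d3 | d3 | d1 = d2 , d1 , d3 , e₁ , e₃
... | d3 | d3 | d2 = d1 , d3 , d1 , e₃ , e₁

i<suc[i] : ∀ i → i < suc i
i<suc[i] i = suc[i]≤j⇒i<j ≤-refl

coord-shift-next : ∀ l p → coord l (shift (next l) p) ≡ coord l p
coord-shift-next d1 (x , y , z) = refl
coord-shift-next d2 (x , y , z) = refl
coord-shift-next d3 (x , y , z) = refl

coord-shift-prev : ∀ l p → coord l (shift (prev l) p) ≡ coord l p
coord-shift-prev d1 (x , y , z) = refl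
coord-shift-prev d2 (x , y , z) = refl
coord-shift-prev d3 (x , y , z) = refl

suc[a-b]≡[a+1]-b : ∀ a b → 1ℤ + (a - b) ≡ (a + 1ℤ) - b
suc[a-b]≡[a+1]-b = solve-∀

suc[a-[b+1]]≡a-b : ∀ a b → 1ℤ + (a - (b + 1ℤ)) ≡ a - b
suc[a-[b+1]]≡a-b = solve-∀

suc[pos]≡pos-shift-next : ∀ l p → suc (pos l p) ≡ pos l (shift (next l) p)
suc[pos]≡pos-shift-next d1 (x , y , z) = suc[a-b]≡[a+1]-b y z
suc[pos]≡pos-shift-next d2 (x , y , z) = suc[a-b]≡[a+1]-b z x
suc[pos]≡pos-shift-next d3 (x , y , z) = suc[a-b]≡[a+1]-b x y

suc[pos-shift-prev]≡pos : ∀ l p → suc (pos l (shift (prev l) p)) ≡ pos l p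
suc[pos-shift-prev]≡pos d1 (x , y , z) = suc[a-[b+1]]≡a-b y z
suc[pos-shift-prev]≡pos d2 (x , y , z) = suc[a-[b+1]]≡a-b z x
suc[pos-shift-prev]≡pos d3 (x , y , z) = suc[a-[b+1]]≡a-b x y

pos<pos-shift-next : ∀ l p → pos l p < pos l (shift (next l) p)
pos<pos-shift-next l p = subst (pos l p <_) (suc[pos]≡pos-shift-next l p) (i<suc[i] (pos l p))

pos-shift-prev<pos : ∀ l p → pos l (shift (prev l) p) < pos l p
pos-shift-prev<pos l p =
  subst (pos l (shift (prev l) p) <_) (suc[pos-shift-prev]≡pos l p) (i<suc[i] (pos l (shift (prev l) p)))

csum-shift : ∀ j p → csum (shift j p) ≡ csum p + 1ℤ
csum-shift d1 (x , y , z) = e x y z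
  where e : ∀ x y z → x + 1ℤ + y + z ≡ x + y + z + 1ℤ
        e = solve-∀
csum-shift d2 (x , y , z) = e x y z
  where e : ∀ x y z → x + (y + 1ℤ) + z ≡ x + y + z + 1ℤ
        e = solve-∀
csum-shift d3 (x , y , z) = e x y z
  where e : ∀ x y z → x + y + (z + 1ℤ) ≡ x + y + z + 1ℤ
        e = solve-∀

csum-shift≢0 : ∀ j p → csum p ≡ 0ℤ → csum (shift j p) ≢ 0ℤ
csum-shift≢0 j p p≡0 shift≡0
  with () ← trans (sym (trans (csum-shift j p) (cong (_+ 1ℤ) p≡0))) shift≡0

edges-agree : ∀ {j k v a b} → Edge j v a → Edge k v b →
              (a ≡ shift j v × b ≡ shift k v) ⊎ (v ≡ shift j a × v ≡ shift k b)
edges-agree (inj₁ (_ , a≡)) (inj₁ (_ , b≡)) = inj₁ (a≡ , b≡)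
edges-agree (inj₂ (_ , v≡)) (inj₂ (_ , v≡′)) = inj₂ (v≡ , v≡′)
edges-agree {k = k} {b = b} (inj₁ (v≡0 , _)) (inj₂ (b≡0 , v≡))
  with () ← csum-shift≢0 k b b≡0 (subst (λ t → csum t ≡ 0ℤ) v≡ v≡0)
edges-agree {j = j} {a = a} (inj₂ (a≡0 , v≡)) (inj₁ (v≡0 , _))
  with () ← csum-shift≢0 j a a≡0 (subst (λ t → csum t ≡ 0ℤ) v≡ v≡0)

OneSided : List Pt → Dir → Pt → Set
OneSided W l v = (∀ u → u ∈ W → coord l u ≡ coord l v → pos l u < pos l v)
               ⊎ (∀ u → u ∈ W → coord l u ≡ coord l v → pos l v < pos l u)

¬OneSided-between : ∀ {W l v a b} → a ∈ W → b ∈ W →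
                    coord l a ≡ coord l v → coord l b ≡ coord l v →
                    pos l a < pos l v → pos l v < pos l b → ¬ OneSided W l v
¬OneSided-between a∈ b∈ ca cb a<v v<b (inj₁ below) = <-asym v<b (below _ b∈ cb)
¬OneSided-between a∈ b∈ ca cb a<v v<b (inj₂ above) = <-asym a<v (above _ a∈ ca)

¬OneSided-row-neighbours : ∀ {W l v a b} → Edge (next l) v a → Edge (prev l) v b →
                           a ∈ W → b ∈ W → ¬ OneSided W l v
¬OneSided-row-neighbours {l = l} {v} e e′ a∈ b∈ with edges-agree e e′
... | inj₁ (refl , refl) =
  ¬OneSided-between {l = l} b∈ a∈ (coord-shift-prev l v) (coord-shift-next l v)
                    (pos-shift-prev<pos l v) (pos<pos-shift-next l v)
¬OneSided-row-neighbours {l = l} {a = a} {b} e e′ a∈ b∈ | inj₂ (v≡ , v≡′) =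
  ¬OneSided-between {l = l} a∈ b∈
    (sym (trans (cong (coord l) v≡) (coord-shift-next l a)))
    (sym (trans (cong (coord l) v≡′) (coord-shift-prev l b)))
    (subst (λ t → pos l a < pos l t) (sym v≡) (pos<pos-shift-next l a))
    (subst (λ t → pos l t < pos l b) (sym v≡′) (pos-shift-prev<pos l b))

module _ {W : List Pt} {i : Dir} {v : Pt} where

  edgeDir : OutermostNeighbor W i v → Dir
  edgeDir (_ , _ , (_ , _ , _ , j , _) , _) = j

  edgeDir≢ : (o : OutermostNeighbor W i v) → edgeDir o ≢ i
  edgeDir≢ (_ , _ , (_ , _ , _ , _ , j≢i , _) , _) = j≢i

  witness : OutermostNeighbor W i v → Pt
  witness (_ , _ , (w , _) , _) = w

  witness-∈ : (o : OutermostNeighbor W i v) → witness o ∈ W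
  witness-∈ (_ , _ , (_ , w∈W , _) , _) = w∈W

  witness-edge : (o : OutermostNeighbor W i v) → Edge (edgeDir o) v (witness o)
  witness-edge (_ , _ , (_ , _ , _ , _ , _ , e) , _) = e

  oneSided : OutermostNeighbor W i v → OneSided W i v
  oneSided (_ , _ , _ , s) = s

lookupDir : {P : Dir → Set} → P d1 × P d2 × P d3 → ∀ i → P i
lookupDir (p₁ , _ , _) d1 = p₁
lookupDir (_ , p₂ , _) d2 = p₂
lookupDir (_ , _ , p₃) d3 = p₃

lemma3 : (W : List Pt) → All IsVertex W → NoBadRow W →
         (v : Pt) → IsVertex v →
         ¬ (OutermostNeighbor W d1 v × OutermostNeighbor W d2 v × OutermostNeighbor W d3 v)
lemma3 W _ _ v _ outermost
  with o ← lookupDir {λ i → OutermostNeighbor W i v} outermost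
  with l , i , i′ , j≡next , k≡prev ←
         fixpointFree⇒hits-next-and-prev (λ i → edgeDir (o i)) (λ i → edgeDir≢ (o i)) =
  ¬OneSided-row-neighbours
    (subst (λ j → Edge j v (witness (o i))) j≡next (witness-edge (o i)))
    (subst (λ k → Edge k v (witness (o i′))) k≡prev (witness-edge (o i′)))
    (witness-∈ (o i)) (witness-∈ (o i′)) (oneSided (o l))
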